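{- Consider a single-suit game of War with WL-putback or with random putback, in which Alice initially holds $m$ cards, and suppose the game is single-use. Then the game graph of the game is a forest consisting of exactly $m$ nontrivial trees together with $x$ isolated vertices, where $x$ is the number of Bob's cards that never get played.
   Context: Single-suit War: a deck of $n$ distinct cards labelled $1,\dots,n$ is split between two players, Alice and Bob, each holding an ordered hand (top to bottom). In a round, both players reveal their top card; the owner of the higher card puts both cards at the bottom of their own hand. Under WL-putback the winning card is put back first and the losing card second (so the losing card becomes the bottom card); under random putback the order of the two cards is chosen uniformly at random. A player who has no cards loses. A game is single-use if Bob wins (Alice runs out of cards) during Bob's first passthrough, i.e. before Bob ever plays a card he won; equivalently every card Bob plays comes from his initial hand. The game graph has the $n$ cards as vertices and one edge for each round, joining the two cards played in that round (multiple edges allowed). -}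

module Defs where

open import Data.Nat using (ℕ; _<_; _≤_; _≟_)
open import Data.Bool using (Bool; true; false)
open import Data.Product using (Σ; _×_; _,_)
open import Data.Sum using (_⊎_)
open import Data.Unit using (⊤)
open import Data.Empty using (⊥)
open import Data.Fin using (Fin)
open import Data.List using (List; []; _∷_; _++_; length; lookup; filter)
open import Data.List.Relation.Unary.Any using (Any; any?)
open import Data.List.Relation.Unary.Unique.Propositional using (Unique)
open import Data.List.Membership.Propositional using (_∈_)
open import Relation.Binary.PropositionalEquality using (_≡_)
open import Relation.Binary.Construct.Closure.ReflexiveTransitive using (Star)
open import Relation.Nullary using (¬_)
open import Relation.Nullary.Decidable using (¬?)
open import Function.Bundles using (_⇔_)

data Rule : Set where
  WL     : Rule
  Random : Rule

-- A putback choice for one round: true = winning card first (WL order),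
-- false = losing card first.  Under WL-putback only `true` is allowed;
-- under random putback, any realisation of the coin flip is allowed.
Allowed : Rule → Bool → Set
Allowed WL     c = c ≡ true
Allowed Random c = ⊤

-- cards appended to the bottom of the winner's hand (w = winner, l = loser)
putback : Bool → ℕ → ℕ → List ℕ
putback true  w l = w ∷ l ∷ []
putback false w l = l ∷ w ∷ []

-- An edge of the game graph: (Alice's card, Bob's card) in that round.
Edge : Set
Edge = ℕ × ℕ

data BobWins (r : Rule) : List ℕ → List ℕ → List Edge → Set where
  end   : ∀ {B} → BobWins r [] B []
  aliceRound : ∀ {a b A B E} (c : Bool) → Allowed r c → b < a →
          BobWins r (A ++ putback c a b) B E →
          BobWins r (a ∷ A) (b ∷ B) ((a , b) ∷ E)
  bobRound : ∀ {a b A B E} (c : Bool) → Allowed r c → a < b →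
          BobWins r A (B ++ putback c b a) E →
          BobWins r (a ∷ A) (b ∷ B) ((a , b) ∷ E)

-- Single-use: Bob wins during his first passthrough, i.e. the number of
-- rounds (= number of cards Bob plays) is at most the size of his initial hand.
SingleUse : List ℕ → List Edge → Set
SingleUse B₀ E = length E ≤ length B₀

Vertex : ℕ → ℕ → Set
Vertex n v = 1 ≤ v × v ≤ n

Incident : ℕ → Edge → Set
Incident v (a , b) = (a ≡ v) ⊎ (b ≡ v)

NonIsolated : List Edge → ℕ → Set
NonIsolated E v = Any (Incident v) E

Adj : List Edge → ℕ → ℕ → Set
Adj E u v = Any (λ e → (e ≡ (u , v)) ⊎ (e ≡ (v , u))) E

Connected : List Edge → ℕ → ℕ → Set
Connected E = Star (Adj E)

Joins : Edge → ℕ → ℕ → Set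
Joins (a , b) u v = (a ≡ u × b ≡ v) ⊎ (a ≡ v × b ≡ u)

-- trail from u to w using the listed edges (by index, so parallel edges are distinct)
data Trail (E : List Edge) : ℕ → ℕ → List (Fin (length E)) → Set where
  nil  : ∀ {u} → Trail E u u []
  cons : ∀ {u v w is} (i : Fin (length E)) → Joins (lookup E i) u v →
         Trail E v w is → Trail E u w (i ∷ is)

Forest : List Edge → Set
Forest E = ∀ v is → Trail E v v is → Unique is → is ≡ []

-- the graph has exactly k nontrivial components (components with ≥ 1 edge):
-- there is a list of k distinct representatives, one per nontrivial component
NontrivialComponents : ℕ → List Edge → ℕ → Set
NontrivialComponents n E k =
  Σ (List ℕ) λ R →
    Unique R × length R ≡ k ×
    (∀ v → v ∈ R → Vertex n v × NonIsolated E v) ×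
    (∀ u v → u ∈ R → v ∈ R → Connected E u v → u ≡ v) ×
    (∀ v → Vertex n v → NonIsolated E v → Any (Connected E v) R)

IsolatedCount : ℕ → List Edge → ℕ → Set
IsolatedCount n E k =
  Σ (List ℕ) λ I →
    Unique I × length I ≡ k ×
    (∀ v → (v ∈ I) ⇔ (Vertex n v × ¬ NonIsolated E v))

unplayed : List ℕ → List Edge → List ℕ
unplayed B₀ E = filter (λ v → ¬? (any? (λ e → Data.Product.proj₂ e ≟ v) E)) B₀
  where import Data.Product

{-# OPTIONS --safe #-}
-- In a single-use game every card Bob plays comes from his initial hand and has
-- never been played before, while every card Alice plays is one of her own or one
-- she has won, i.e. a card already seen.  So each round attaches a new leaf to the
-- graph grown so far from Alice's initial cards: the game graph is a forest with
-- one tree per initial card of Alice (she plays each of them, having lost), and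
-- its isolated vertices are exactly Bob's cards that are never played.
module Submission where

open import Defs
open import Data.Nat using (ℕ; suc; _≤_; z≤n; s≤s; _≟_)
open import Data.Nat.Properties using (suc-injective)
open import Data.Product using (_×_; _,_; proj₁; proj₂; uncurry)
open import Data.Sum using (_⊎_; inj₁; inj₂; [_,_]′)
open import Data.Unit using (⊤; tt)
open import Data.Bool using (true; false)
open import Data.Fin using (Fin; zero; suc)
import Data.Fin as Fin
open import Data.Fin.Properties using (≤-totalOrder; ≤∧≢⇒<)
open import Data.List using (List; []; _∷_; _++_; length; map; upTo; lookup)
open import Data.List.Properties using (++-assoc; ++-identityʳ)
import Data.List.Extrema
open import Data.List.Relation.Binary.Disjoint.Propositional using (Disjoint)
open import Data.List.Relation.Binary.Permutation.Propositional using (_↭_; ↭-sym; ↭⇒↭ₛ)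
open import Data.List.Relation.Binary.Permutation.Setoid.Properties using (Unique-resp-↭)
open import Data.List.Relation.Binary.Permutation.Propositional.Properties using (∈-resp-↭)
open import Data.List.Relation.Unary.Any using (Any; here; there; any?)
import Data.List.Relation.Unary.Any as Any
open import Data.List.Relation.Unary.Any.Properties using (Any-⊎⁻)
open import Data.List.Relation.Unary.All using (All; []; _∷_)
import Data.List.Relation.Unary.All as All
open import Data.List.Relation.Unary.All.Properties using (++⁺; ++⁻ˡ; ++⁻ʳ)
open import Data.List.Relation.Unary.AllPairs using (_∷_)
open import Data.List.Relation.Unary.Unique.Propositional using (Unique; [])
open import Data.List.Relation.Unary.Unique.Propositional.Properties as Unique using ()
open import Data.List.Membership.Propositional using (_∈_; _∉_; lose)
open import Data.List.Membership.Propositional.Properties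
  using (∈-map⁻; ∈-map⁺; ∈-++⁺ˡ; ∈-++⁺ʳ; ∈-++⁻; ∈-filter⁺; ∈-filter⁻; ∈-upTo⁺; ∈-upTo⁻)
open import Relation.Binary.PropositionalEquality
  using (_≡_; _≢_; refl; sym; trans; cong; setoid; ≢-sym; module ≡-Reasoning)
open import Relation.Binary.Construct.Closure.ReflexiveTransitive using (ε; _◅_; _◅◅_)
import Relation.Binary.Construct.Closure.ReflexiveTransitive as Star
open import Relation.Nullary using (¬_; yes; no; ¬?; contradiction)
import Relation.Unary
open import Function.Base using (id; _∘_)
open import Function.Bundles using (mk⇔)

∈∧∉⇒≢ : ∀ {x y : ℕ} {S} → x ∈ S → y ∉ S → x ≢ y
∈∧∉⇒≢ x∈S y∉S refl = y∉S x∈S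

record LeafOrdered (E : List Edge) : Set where
  field
    loopless : ∀ i → proj₁ (lookup E i) ≢ proj₂ (lookup E i)
    new-leaf : ∀ {i j} → j Fin.< i → ¬ Incident (proj₂ (lookup E i)) (lookup E j)

module _ {e : Edge} {u v : ℕ} where

  Joins⇒Incidentˡ : Joins e u v → Incident u e
  Joins⇒Incidentˡ (inj₁ (p , _)) = inj₁ p
  Joins⇒Incidentˡ (inj₂ (_ , q)) = inj₂ q

  Joins⇒Incidentʳ : Joins e u v → Incident v e
  Joins⇒Incidentʳ (inj₁ (_ , q)) = inj₂ q
  Joins⇒Incidentʳ (inj₂ (p , _)) = inj₁ p

  Joins∧Incident⇒endpoint : ∀ {b} → Joins e u v → Incident b e → u ≡ b ⊎ v ≡ b
  Joins∧Incident⇒endpoint (inj₁ (refl , refl)) (inj₁ refl) = inj₁ refl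
  Joins∧Incident⇒endpoint (inj₁ (refl , refl)) (inj₂ refl) = inj₂ refl
  Joins∧Incident⇒endpoint (inj₂ (refl , refl)) (inj₁ refl) = inj₂ refl
  Joins∧Incident⇒endpoint (inj₂ (refl , refl)) (inj₂ refl) = inj₁ refl

Joins-self⇒loop : ∀ {e : Edge} {u} → Joins e u u → proj₁ e ≡ proj₂ e
Joins-self⇒loop (inj₁ (p , q)) = trans p (sym q)
Joins-self⇒loop (inj₂ (p , q)) = trans p (sym q)

module _ {E : List Edge} where

  private
    Touches : Fin (length E) → ℕ → Set
    Touches i b = Incident b (lookup E i)

  trail-avoids : ∀ {u w is b} → Trail E u w is → All (λ i → ¬ Touches i b) is →
                 u ≢ b → w ≢ b
  trail-avoids nil          _          u≢b = u≢b
  trail-avoids (cons i J T) (¬t ∷ ¬ts) _   =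
    trail-avoids T ¬ts λ { refl → ¬t (Joins⇒Incidentʳ J) }

  -- An edge-simple trail meets a vertex touched by only one non-loop edge of it an
  -- odd number of times, hence exactly at one of its two ends.
  trail-through-leaf : ∀ {u w is k b} → Trail E u w is → Unique is → k ∈ is →
                       proj₁ (lookup E k) ≢ proj₂ (lookup E k) → Touches k b →
                       All (λ i → i ≢ k → ¬ Touches i b) is →
                       (u ≡ b × w ≢ b) ⊎ (w ≡ b × u ≢ b)
  trail-through-leaf {k = k} (cons i J T) (_ ∷ is!) k∈ loopless t (h ∷ hs) with i Fin.≟ k
  ... | no i≢k with k∈
  ...   | here k≡i = contradiction (sym k≡i) i≢k
  ...   | there k∈is with trail-through-leaf T is! k∈is loopless t hs
  ...     | inj₁ (refl , _)   = contradiction (Joins⇒Incidentʳ J) (h i≢k)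
  ...     | inj₂ (w≡b , _)    = inj₂ (w≡b , λ { refl → h i≢k (Joins⇒Incidentˡ J) })
  trail-through-leaf {b = b} (cons {is = js} i J T) (i∉js ∷ _) _ loopless t (h ∷ hs)
    | yes refl
    with Joins∧Incident⇒endpoint J t
  ... | inj₁ refl = inj₁ (refl , trail-avoids T others-avoid
                                   λ { refl → loopless (Joins-self⇒loop J) })
    where
    others-avoid : All (λ j → ¬ Touches j b) js
    others-avoid = All.zipWith (λ (i≢j , hj) → hj (≢-sym i≢j)) (i∉js , hs)
  ... | inj₂ refl = inj₂ (ends-at-leaf T hs i∉js , λ { refl → loopless (Joins-self⇒loop J) })
    where
    ends-at-leaf : ∀ {w ls} → Trail E b w ls → All (λ l → l ≢ i → ¬ Touches l b) ls →
                   All (i ≢_) ls → w ≡ b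
    ends-at-leaf nil           _        _         = refl
    ends-at-leaf (cons j J′ _) (hj ∷ _) (i≢j ∷ _) =
      contradiction (Joins⇒Incidentˡ J′) (hj (≢-sym i≢j))

  private
    module Max = Data.List.Extrema (≤-totalOrder (length E))

    max∈ : ∀ i is → Max.max i is ∈ i ∷ is
    max∈ i is = [ here , there ]′ (Max.argmax-sel id i is)

    ≤max : ∀ i is → All (Fin._≤ Max.max i is) (i ∷ is)
    ≤max i is = Max.⊥≤max i is ∷ Max.xs≤max i is

  -- The edge of largest index on a cycle would touch its second endpoint only once.
  LeafOrdered⇒Forest : LeafOrdered E → Forest E
  LeafOrdered⇒Forest _       v []       _ _  = refl
  LeafOrdered⇒Forest ordered v (i ∷ is) T is! =
    [ uncurry contradiction , uncurry contradiction ]′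
      (trail-through-leaf T is! (max∈ i is) (loopless k) (inj₂ refl)
        (All.map (λ j≤k j≢k → new-leaf (≤∧≢⇒< j≤k j≢k)) (≤max i is)))
    where
    open LeafOrdered ordered
    k : Fin (length E)
    k = Max.max i is

GrowsFrom : List ℕ → List Edge → Set
GrowsFrom S []            = ⊤
GrowsFrom S ((a , b) ∷ E) = a ∈ S × b ∉ S × GrowsFrom (b ∷ S) E

PlayedByAlice : List Edge → ℕ → Set
PlayedByAlice E v = Any (λ e → proj₁ e ≡ v) E

PlayedByBob : List Edge → ℕ → Set
PlayedByBob E v = Any (λ e → proj₂ e ≡ v) E

growsFrom⇒loopless : ∀ {S E} → GrowsFrom S E → ∀ i → proj₁ (lookup E i) ≢ proj₂ (lookup E i)
growsFrom⇒loopless {E = _ ∷ _} (a∈S , b∉S , _) zero    = ∈∧∉⇒≢ a∈S b∉S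
growsFrom⇒loopless {E = _ ∷ _} (_   , _   , g) (suc i) = growsFrom⇒loopless g i

growsFrom⇒second-unseen : ∀ {S E} → GrowsFrom S E → ∀ i → proj₂ (lookup E i) ∉ S
growsFrom⇒second-unseen {E = _ ∷ _} (_ , b∉S , _) zero    = b∉S
growsFrom⇒second-unseen {E = _ ∷ _} (_ , _   , g) (suc i) = growsFrom⇒second-unseen g i ∘ there

growsFrom⇒new-leaf : ∀ {S E} → GrowsFrom S E → ∀ {i j} → j Fin.< i →
                     ¬ Incident (proj₂ (lookup E i)) (lookup E j)
growsFrom⇒new-leaf {E = _ ∷ _} (a∈S , _ , g) {suc i} {zero} _ (inj₁ refl) =
  growsFrom⇒second-unseen g i (there a∈S)
growsFrom⇒new-leaf {E = _ ∷ _} (_ , _ , g) {suc i} {zero} _ (inj₂ refl) =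
  growsFrom⇒second-unseen g i (here refl)
growsFrom⇒new-leaf {E = _ ∷ _} (_ , _ , g) {suc i} {suc j} (s≤s j<i) =
  growsFrom⇒new-leaf g j<i

growsFrom⇒leafOrdered : ∀ {S E} → GrowsFrom S E → LeafOrdered E
growsFrom⇒leafOrdered g = record
  { loopless = growsFrom⇒loopless g
  ; new-leaf = growsFrom⇒new-leaf g
  }

-- Read from the back, each edge (a , b) sends b to a; this maps every vertex of a
-- graph grown from S to the seed at the root of its tree.
rename : ℕ → ℕ → ℕ → ℕ
rename b a x with x ≟ b
... | yes _ = a
... | no  _ = x

rename-hit : ∀ {b a} → rename b a b ≡ a
rename-hit {b} with b ≟ b
... | yes _   = refl
... | no  b≢b = contradiction refl b≢b

rename-miss : ∀ {b a x} → x ≢ b → rename b a x ≡ x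
rename-miss {b} {x = x} x≢b with x ≟ b
... | yes x≡b = contradiction x≡b x≢b
... | no  _   = refl

root : List Edge → ℕ → ℕ
root []            v = v
root ((a , b) ∷ E) v = rename b a (root E v)

root-fixes-seeds : ∀ {S E v} → GrowsFrom S E → v ∈ S → root E v ≡ v
root-fixes-seeds {E = []}        _             _   = refl
root-fixes-seeds {E = _ ∷ _} (_ , b∉S , g) v∈S =
  trans (cong (rename _ _) (root-fixes-seeds g (there v∈S))) (rename-miss (∈∧∉⇒≢ v∈S b∉S))

root-joins : ∀ {S a b E} → GrowsFrom S ((a , b) ∷ E) →
             root ((a , b) ∷ E) a ≡ root ((a , b) ∷ E) b
root-joins {a = a} {b} {E} (a∈S , b∉S , g) = begin
  rename b a (root E a) ≡⟨ cong (rename b a) (root-fixes-seeds g (there a∈S)) ⟩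
  rename b a a          ≡⟨ rename-miss (∈∧∉⇒≢ a∈S b∉S) ⟩
  a                     ≡⟨ rename-hit {b} ⟨
  rename b a b          ≡⟨ cong (rename b a) (root-fixes-seeds g (here refl)) ⟨
  rename b a (root E b) ∎
  where open ≡-Reasoning

root-respects-Adj : ∀ {S E u v} → GrowsFrom S E → Adj E u v → root E u ≡ root E v
root-respects-Adj {E = _ ∷ _} g           (here (inj₁ refl)) = root-joins g
root-respects-Adj {E = _ ∷ _} g           (here (inj₂ refl)) = sym (root-joins g)
root-respects-Adj {E = _ ∷ _} (_ , _ , g) (there adj)        =
  cong (rename _ _) (root-respects-Adj g adj)

root-respects-Connected : ∀ {S E u v} → GrowsFrom S E → Connected E u v → root E u ≡ root E v
root-respects-Connected g ε          = refl
root-respects-Connected g (adj ◅ c) = trans (root-respects-Adj g adj) (root-respects-Connected g c)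

seeds-disconnected : ∀ {S E u v} → GrowsFrom S E → u ∈ S → v ∈ S → Connected E u v → u ≡ v
seeds-disconnected {E = E} {u} {v} g u∈S v∈S c = begin
  u        ≡⟨ root-fixes-seeds g u∈S ⟨
  root E u ≡⟨ root-respects-Connected g c ⟩
  root E v ≡⟨ root-fixes-seeds g v∈S ⟩
  v        ∎
  where open ≡-Reasoning

nonIsolated⇒reaches-seed : ∀ {S E v} → GrowsFrom S E → NonIsolated E v → Any (Connected E v) S
nonIsolated⇒reaches-seed {E = _ ∷ _} (a∈S , _ , _) (here (inj₁ refl)) = lose a∈S ε
nonIsolated⇒reaches-seed {E = _ ∷ _} (a∈S , _ , _) (here (inj₂ refl)) =
  lose a∈S (here (inj₂ refl) ◅ ε)
nonIsolated⇒reaches-seed {E = _ ∷ _} (a∈S , _ , g) (there p) with nonIsolated⇒reaches-seed g p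
... | here refl⇝b = lose a∈S (Star.map there refl⇝b ◅◅ here (inj₂ refl) ◅ ε)
... | there ⇝S    = Any.map (Star.map there) ⇝S

playedByAlice⇒seed⊎playedByBob : ∀ {S E v} → GrowsFrom S E → PlayedByAlice E v →
                                 v ∈ S ⊎ PlayedByBob E v
playedByAlice⇒seed⊎playedByBob {E = _ ∷ _} (a∈S , _ , _) (here refl) = inj₁ a∈S
playedByAlice⇒seed⊎playedByBob {E = _ ∷ _} (_ , _ , g) (there p)
  with playedByAlice⇒seed⊎playedByBob g p
... | inj₁ (here refl) = inj₂ (here refl)
... | inj₁ (there v∈S) = inj₁ v∈S
... | inj₂ q           = inj₂ (there q)

nonIsolated⇒seed⊎playedByBob : ∀ {S E v} → GrowsFrom S E → NonIsolated E v →
                               v ∈ S ⊎ PlayedByBob E v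
nonIsolated⇒seed⊎playedByBob g touched with Any-⊎⁻ touched
... | inj₁ byAlice = playedByAlice⇒seed⊎playedByBob g byAlice
... | inj₂ byBob   = inj₂ byBob

putback-⊆ : ∀ c {x y} {S : List ℕ} → x ∈ S → y ∈ S → All (_∈ S) (putback c x y)
putback-⊆ true  x∈S y∈S = x∈S ∷ y∈S ∷ []
putback-⊆ false x∈S y∈S = y∈S ∷ x∈S ∷ []

∉-∷⁺ : ∀ {b : ℕ} {S F} → All (b ≢_) F → All (_∉ S) F → All (_∉ b ∷ S) F
∉-∷⁺ b≢F F∉S = All.zipWith
  (λ { (b≢x , _  ) (here x≡b)  → b≢x (sym x≡b)
     ; (_   , x∉S) (there x∈S) → x∉S x∈S })
  (b≢F , F∉S)

-- F is what remains of Bob's first passthrough and W what he has won since; S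
-- holds every card Alice may still play.
firstPass⇒growsFrom : ∀ {r A B E} → BobWins r A B E →
                      ∀ {S F W} → B ≡ F ++ W → length E ≤ length F → Unique F →
                      All (_∈ S) A → All (_∉ S) F → GrowsFrom S E
firstPass⇒growsFrom end _ _ _ _ _ = tt
firstPass⇒growsFrom (aliceRound c _ _ game) {F = b ∷ F} refl (s≤s short) (b∉F ∷ F!)
  (a∈S ∷ A⊆S) (b∉S ∷ F∉S) =
  a∈S , b∉S ,
  firstPass⇒growsFrom game refl short F!
    (++⁺ (All.map there A⊆S) (putback-⊆ c (there a∈S) (here refl)))
    (∉-∷⁺ b∉F F∉S)
firstPass⇒growsFrom (bobRound _ _ _ game) {F = b ∷ F} {W} refl (s≤s short) (b∉F ∷ F!)
  (a∈S ∷ A⊆S) (b∉S ∷ F∉S) =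
  a∈S , b∉S ,
  firstPass⇒growsFrom game (++-assoc F W _) short F! (All.map there A⊆S) (∉-∷⁺ b∉F F∉S)

singleUse⇒growsFrom : ∀ {r A B E} → BobWins r A B E → SingleUse B E → Unique B →
                      Disjoint A B → GrowsFrom A E
singleUse⇒growsFrom game short B! A#B =
  firstPass⇒growsFrom game (sym (++-identityʳ _)) short B!
    (All.tabulate id) (All.tabulate λ v∈B v∈A → A#B (v∈A , v∈B))

bobWins⇒alice-plays-all : ∀ {r A B E} → BobWins r A B E → All (PlayedByAlice E) A
bobWins⇒alice-plays-all end                             = []
bobWins⇒alice-plays-all (aliceRound {A = A} _ _ _ game) =
  here refl ∷ All.map there (++⁻ˡ A (bobWins⇒alice-plays-all game))
bobWins⇒alice-plays-all (bobRound _ _ _ game)           =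
  here refl ∷ All.map there (bobWins⇒alice-plays-all game)

∈-vertices⁻ : ∀ {n v} → v ∈ map suc (upTo n) → Vertex n v
∈-vertices⁻ v∈ with ∈-map⁻ suc v∈
... | _ , i∈ , refl = s≤s z≤n , ∈-upTo⁻ i∈

∈-vertices⁺ : ∀ {n v} → Vertex n v → v ∈ map suc (upTo n)
∈-vertices⁺ {v = suc _} (s≤s z≤n , v≤n) = ∈-map⁺ suc (∈-upTo⁺ v≤n)

Unique-++⁻ : ∀ (xs : List ℕ) {ys} → Unique (xs ++ ys) → Unique xs × Unique ys × Disjoint xs ys
Unique-++⁻ []       ys!                      = [] , ys! , λ ()
Unique-++⁻ (x ∷ xs) (x∉xs++ys ∷ xs++ys!) with Unique-++⁻ xs xs++ys!
... | xs! , ys! , xs#ys = ++⁻ˡ xs x∉xs++ys ∷ xs! , ys! , λ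
  { (here refl , v∈ys) → All.lookup (++⁻ʳ xs x∉xs++ys) v∈ys refl
  ; (there v∈xs , v∈ys) → xs#ys (v∈xs , v∈ys) }

module Dealt {n} {A B : List ℕ} (deal : (A ++ B) ↭ map suc (upTo n)) where

  private
    A++B! : Unique (A ++ B)
    A++B! = Unique-resp-↭ (setoid ℕ) (↭⇒↭ₛ (↭-sym deal)) (Unique.map⁺ suc-injective (Unique.upTo⁺ n))

    dealt⇒vertex : ∀ {v} → v ∈ A ++ B → Vertex n v
    dealt⇒vertex = ∈-vertices⁻ ∘ ∈-resp-↭ deal

    vertex⇒dealt : ∀ {v} → Vertex n v → v ∈ A ++ B
    vertex⇒dealt = ∈-resp-↭ (↭-sym deal) ∘ ∈-vertices⁺

  A! : Unique A
  A! = proj₁ (Unique-++⁻ A A++B!)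

  B! : Unique B
  B! = proj₁ (proj₂ (Unique-++⁻ A A++B!))

  A#B : Disjoint A B
  A#B = proj₂ (proj₂ (Unique-++⁻ A A++B!))

  nontrivialComponents : ∀ {E} → GrowsFrom A E → All (PlayedByAlice E) A →
                         NontrivialComponents n E (length A)
  nontrivialComponents g played =
    A , A! , refl ,
    (λ v v∈A → dealt⇒vertex (∈-++⁺ˡ v∈A) , Any.map inj₁ (All.lookup played v∈A)) ,
    (λ _ _ → seeds-disconnected g) ,
    (λ _ _ → nonIsolated⇒reaches-seed g)

  isolatedCount : ∀ {E} → GrowsFrom A E → All (PlayedByAlice E) A →
                  IsolatedCount n E (length (unplayed B E))
  isolatedCount {E} g played =
    unplayed B E , Unique.filter⁺ unplayed? B! , refl , λ v → mk⇔ isolated isolated⁻¹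
    where
    unplayed? : Relation.Unary.Decidable (λ v → ¬ PlayedByBob E v)
    unplayed? v = ¬? (any? (λ e → proj₂ e ≟ v) E)

    isolated : ∀ {v} → v ∈ unplayed B E → Vertex n v × ¬ NonIsolated E v
    isolated v∈ with ∈-filter⁻ unplayed? v∈
    ... | v∈B , ¬byBob = dealt⇒vertex (∈-++⁺ʳ A v∈B) , λ touched →
      [ (λ v∈A → A#B (v∈A , v∈B)) , ¬byBob ]′ (nonIsolated⇒seed⊎playedByBob g touched)

    isolated⁻¹ : ∀ {v} → Vertex n v × ¬ NonIsolated E v → v ∈ unplayed B E
    isolated⁻¹ (vertex , untouched) with ∈-++⁻ A (vertex⇒dealt vertex)
    ... | inj₁ v∈A = contradiction (Any.map inj₁ (All.lookup played v∈A)) untouched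
    ... | inj₂ v∈B = ∈-filter⁺ unplayed? v∈B (untouched ∘ Any.map inj₂)

proposition3p1 : (r : Rule) (n : ℕ) (A₀ B₀ : List ℕ) (E : List Edge) →
    (A₀ ++ B₀) ↭ map suc (upTo n) →
    BobWins r A₀ B₀ E →
    SingleUse B₀ E →
    Forest E ×
    NontrivialComponents n E (length A₀) ×
    IsolatedCount n E (length (unplayed B₀ E))
proposition3p1 r n A₀ B₀ E deal game singleUse =
  LeafOrdered⇒Forest (growsFrom⇒leafOrdered grows) ,
  nontrivialComponents grows played ,
  isolatedCount grows played
  where
  open Dealt {A = A₀} {B₀} deal
  grows : GrowsFrom A₀ E
  grows = singleUse⇒growsFrom game singleUse B! A#B
  played : All (PlayedByAlice E) A₀
  played = bobWins⇒alice-plays-all game
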